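{- Let $F$ be a field, $n\in\mathbb{N}$, and let $p,q\in\mathbb{N}$ satisfy $p+q\leq n+1$. Let $r\in\mathbb{N}$ satisfy $r+1\leq p$ and $r+1\leq q$. Let $x\in F^{n+1}$. Then $\operatorname{rank}(H_{p,q-1}(x))\leq r$ if and only if $\operatorname{rank}(H_{p-1,q}(x))\leq r$.
   Context: $\mathbb{N}=\{0,1,2,\ldots\}$. For $x=(x_0,x_1,\ldots,x_n)\in F^{n+1}$ and integers $p,s\in\{ -1,0,1,\ldots\}$ with $p+s\leq n$, $H_{p,s}(x)$ is the $(p+1)\times(s+1)$ matrix $(x_{i+j})_{0\leq i\leq p,\ 0\leq j\leq s}$. -}

module Defs where

open import Level using (Level; _⊔_) renaming (suc to lsuc)
open import Data.Nat.Base using (ℕ; zero; suc) renaming (_+_ to _+ℕ_)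
open import Data.Nat.Properties using (_<?_)
open import Data.Fin.Base using (Fin; toℕ; fromℕ<)
open import Data.Product using (∃; Σ; _,_)
open import Relation.Nullary using (¬_; yes; no)
open import Algebra.Bundles using (CommutativeRing)
import Algebra.Properties.Monoid.Sum as MonoidSum

record Field (c ℓ : Level) : Set (lsuc (c ⊔ ℓ)) where
  field
    commutativeRing : CommutativeRing c ℓ
  open CommutativeRing commutativeRing public
  field
    1≉0     : ¬ (1# ≈ 0#)
    inverse : ∀ x → ¬ (x ≈ 0#) → ∃ λ y → x * y ≈ 1#

module FieldDefs {c ℓ : Level} (F : Field c ℓ) where
  open Field F
  open MonoidSum +-monoid using (sum)

  Matrix : ℕ → ℕ → Set c
  Matrix m k = Fin m → Fin k → Carrier

  column : ∀ {m k} → Matrix m k → Fin k → Fin m → Carrier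
  column A j i = A i j

  LinearlyIndependent : ∀ {m t} → (Fin t → Fin m → Carrier) → Set (c ⊔ ℓ)
  LinearlyIndependent {m} {t} v =
    (a : Fin t → Carrier) →
    (∀ i → sum (λ j → a j * v j i) ≈ 0#) →
    ∀ j → a j ≈ 0#

  RankLE : ∀ {m k} → Matrix m k → ℕ → Set (c ⊔ ℓ)
  RankLE {m} {k} A r =
    ¬ (Σ (Fin (suc r) → Fin k) λ f → LinearlyIndependent (λ t → column A (f t)))

  -- Entry x_k of x ∈ F^{n+1}; indices k > n never occur in the uses below
  -- (they are sent to 0# only to make the function total).
  entry : ∀ {n} → (Fin (suc n) → Carrier) → ℕ → Carrier
  entry {n} x k with k <? suc n
  ... | yes k<n+1 = x (fromℕ< k<n+1)
  ... | no _    = 0#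

  -- Hankel matrix with `rows` rows and `cols` columns: entries x_{i+j}.
  -- H_{p,s}(x) from the paper is  hankel (suc p) (suc s) x.
  hankel : ∀ {n} → (rows cols : ℕ) → (Fin (suc n) → Carrier) → Matrix rows cols
  hankel rows cols x i j = entry x (toℕ i +ℕ toℕ j)

{-# OPTIONS --safe #-}
-- Let α_j ∈ F^{p+1} (j < q) be the columns of H_{p,q-1}(x) and β_j ∈ F^p (j ≤ q) those of
-- H_{p-1,q}(x): β_j is α_j without its last entry, and α_j without its first entry is β_{j+1}.
-- Suppose rank H_{p,q-1} ≤ r and β_{j_0}, …, β_{j_r} are independent. If every j_i < q the
-- α_{j_i} are independent too. Otherwise one of them is β_q and the other r, with indices < q,
-- are independent as β's and hence as α's; by the rank bound they span every α_j, j < q.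
-- Take a relation Σ λ_i α_i = 0 among α_0, …, α_r with last nonzero coefficient λ_k. Each
-- shift Σ λ_i α_{i+d+1} lies in that span and its truncation is the previous shift with its
-- first entry dropped, so by induction Σ λ_i α_{i+d} = 0 while k + d < q, truncation being
-- injective on the span. At d = q - 1 - k dropping the first entry leaves λ_k β_q in the span
-- of the other β's, a contradiction. The converse is the same statement for the transposed
-- Hankel matrices, since transposition preserves ranks (by Gaussian elimination).
-- All case distinctions on field elements are made under a double negation, which suffices
-- because a rank bound is a negated statement.
module Submission where

open import Defs

open import Level using (Level; _⊔_)
open import Function.Base using (_∘_)
open import Data.Nat.Base as ℕ using (ℕ; zero; suc; _≤_; _<_; _∸_)
import Data.Nat.Properties as ℕₚ
open import Data.Fin.Base using (Fin; zero; suc; toℕ; fromℕ<; inject₁; punchIn)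
import Data.Fin.Properties as Finₚ
open import Data.Product using (Σ; ∃; _×_; _,_; proj₁; proj₂)
open import Data.Sum using (_⊎_; inj₁; inj₂)
import Data.Sum as Sum
open import Data.Vec.Functional using (Vector; _∷_; insertAt)
import Data.Vec.Functional.Properties as Vecₚ
open import Relation.Nullary using (¬_; yes; no)
open import Relation.Binary.Definitions using (tri<; tri≈; tri>)
open import Relation.Nullary.Negation using (contradiction; negated-stable; ¬¬-map)
open import Relation.Nullary.Decidable using (¬¬-excluded-middle)
import Relation.Binary.PropositionalEquality as ≡

private
  variable
    a b : Level
    A : Set a
    B : Set b

_>>=_ : ¬ ¬ A → (A → ¬ ¬ B) → ¬ ¬ B
m >>= f = negated-stable (¬¬-map f m)

return : A → ¬ ¬ A
return = contradiction

¬¬-∀-Fin : ∀ {n} {X : Fin n → Set a} → (∀ j → ¬ ¬ X j) → ¬ ¬ (∀ j → X j)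
¬¬-∀-Fin {n = zero}  h = return λ ()
¬¬-∀-Fin {n = suc n} h =
  h zero >>= λ x₀ →
  ¬¬-∀-Fin (h ∘ suc) >>= λ xs →
  return λ { zero → x₀ ; (suc j) → xs j }

¬¬-∀-< : ∀ {n} {X : ℕ → Set a} → (∀ j → j < n → ¬ ¬ X j) → ¬ ¬ (∀ j → j < n → X j)
¬¬-∀-< {X = X} h = ¬¬-map
  (λ all j j<n → ≡.subst X (Finₚ.toℕ-fromℕ< j<n) (all (fromℕ< j<n)))
  (¬¬-∀-Fin (λ j → h (toℕ j) (Finₚ.toℕ<n j)))

module LinearAlgebra {c ℓ : Level} (F : Field c ℓ) where
  open Field F hiding (zero)
  open FieldDefs F
  open import Algebra.Properties.Ring ring
    using (-‿distribˡ-*; -‿involutive; -0#≈0#; -1*x≈-x; +-cancelʳ; +-inverseˡ-unique)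
  open import Algebra.Properties.CommutativeSemigroup *-commutativeSemigroup
    using (x∙yz≈y∙xz)
  open import Algebra.Properties.Semiring.Sum semiring
    using ( sum; sum-cong-≋; sum-remove; sum-replicate-zero
          ; ∑-distrib-+; *-distribˡ-sum; *-distribʳ-sum)
  open import Relation.Binary.Reasoning.Setoid setoid

  lincomb : ∀ {t m} → Vector Carrier t → (Fin t → Vector Carrier m) → Vector Carrier m
  lincomb a v i = sum (λ j → a j * v j i)

  LinearlyDependent : ∀ {t m} → (Fin t → Vector Carrier m) → Set (c ⊔ ℓ)
  LinearlyDependent {t} v =
    Σ (Vector Carrier t) λ a → (∀ i → lincomb a v i ≈ 0#) × ∃ λ j → ¬ a j ≈ 0#

  InSpan : ∀ {r m} → (Fin r → Vector Carrier m) → Vector Carrier m → Set (c ⊔ ℓ)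
  InSpan {r} G u = Σ (Vector Carrier r) λ μ → ∀ i → u i ≈ lincomb μ G i

  basis : ∀ {n} → Fin n → Vector Carrier n
  basis zero    = 1# ∷ λ _ → 0#
  basis (suc j) = 0# ∷ basis j

  *-cancelʳ-nonzero : ∀ {x y z} → ¬ z ≈ 0# → x * z ≈ y * z → x ≈ y
  *-cancelʳ-nonzero {x} {y} {z} z≉0 xz≈yz with inverse z z≉0
  ... | z⁻¹ , zz⁻¹≈1 = begin
    x              ≈⟨ sym (*-identityʳ x) ⟩
    x * 1#         ≈⟨ *-congˡ (sym zz⁻¹≈1) ⟩
    x * (z * z⁻¹)  ≈⟨ sym (*-assoc x z z⁻¹) ⟩
    (x * z) * z⁻¹  ≈⟨ *-congʳ xz≈yz ⟩
    (y * z) * z⁻¹  ≈⟨ *-assoc y z z⁻¹ ⟩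
    y * (z * z⁻¹)  ≈⟨ *-congˡ zz⁻¹≈1 ⟩
    y * 1#         ≈⟨ *-identityʳ y ⟩
    y              ∎

  x*y≈0⇒x≈0 : ∀ {x y} → ¬ y ≈ 0# → x * y ≈ 0# → x ≈ 0#
  x*y≈0⇒x≈0 {y = y} y≉0 xy≈0 = *-cancelʳ-nonzero y≉0 (trans xy≈0 (sym (zeroˡ y)))

  -x≈0⇒x≈0 : ∀ {x} → - x ≈ 0# → x ≈ 0#
  -x≈0⇒x≈0 {x} -x≈0 = trans (sym (-‿involutive x)) (trans (-‿cong -x≈0) -0#≈0#)

  sum-zero : ∀ {n} (f : Vector Carrier n) → (∀ j → f j ≈ 0#) → sum f ≈ 0#
  sum-zero {n} f f≈0 = trans (sum-cong-≋ f≈0) (sum-replicate-zero n)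

  lincomb-zeroˡ : ∀ {t m} {a : Vector Carrier t} (v : Fin t → Vector Carrier m) →
                  (∀ j → a j ≈ 0#) → ∀ i → lincomb a v i ≈ 0#
  lincomb-zeroˡ v a≈0 i = sum-zero _ (λ j → trans (*-congʳ (a≈0 j)) (zeroˡ _))

  lincomb-zeroʳ : ∀ {t m} (a : Vector Carrier t) (v : Fin t → Vector Carrier m) {i} →
                  (∀ j → v j i ≈ 0#) → lincomb a v i ≈ 0#
  lincomb-zeroʳ a v v≈0 = sum-zero _ (λ j → trans (*-congˡ (v≈0 j)) (zeroʳ _))

  lincomb-congˡ : ∀ {t m} (a b : Vector Carrier t) (v : Fin t → Vector Carrier m) →
                  (∀ j → a j ≈ b j) → ∀ i → lincomb a v i ≈ lincomb b v i
  lincomb-congˡ a b v a≈b i = sum-cong-≋ (λ j → *-congʳ (a≈b j))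

  lincomb-congʳ : ∀ {t m} (a : Vector Carrier t) (v w : Fin t → Vector Carrier m) {i} →
                  (∀ j → v j i ≈ w j i) → lincomb a v i ≈ lincomb a w i
  lincomb-congʳ a v w v≈w = sum-cong-≋ (λ j → *-congˡ (v≈w j))

  lincomb-+ˡ : ∀ {t m} (a b : Vector Carrier t) (v : Fin t → Vector Carrier m) i →
               lincomb (λ j → a j + b j) v i ≈ lincomb a v i + lincomb b v i
  lincomb-+ˡ a b v i =
    trans (sum-cong-≋ (λ j → distribʳ (v j i) (a j) (b j)))
          (∑-distrib-+ (λ j → a j * v j i) (λ j → b j * v j i))

  lincomb-*ˡ : ∀ {t m} (x : Carrier) (a : Vector Carrier t) (v : Fin t → Vector Carrier m) i →
               lincomb (λ j → x * a j) v i ≈ x * lincomb a v i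
  lincomb-*ˡ x a v i =
    trans (sum-cong-≋ (λ j → *-assoc x (a j) (v j i))) (sym (*-distribˡ-sum x (λ j → a j * v j i)))

  lincomb-basis : ∀ {t m} (j : Fin t) (v : Fin t → Vector Carrier m) i →
                  lincomb (basis j) v i ≈ v j i
  lincomb-basis zero v i =
    trans (+-cong (*-identityˡ _) (lincomb-zeroˡ (v ∘ suc) (λ _ → refl) i)) (+-identityʳ _)
  lincomb-basis (suc j) v i =
    trans (+-cong (zeroˡ _) (lincomb-basis j (v ∘ suc) i)) (+-identityˡ _)

  lincomb-insertAt : ∀ {t m} (ν : Vector Carrier t) (t₁ : Fin (suc t)) (z : Carrier)
                     (v : Fin (suc t) → Vector Carrier m) i →
                     lincomb (insertAt ν t₁ z) v i ≈ z * v t₁ i + lincomb ν (v ∘ punchIn t₁) i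
  lincomb-insertAt ν t₁ z v i = trans
    (sum-remove {i = t₁} (λ j → insertAt ν t₁ z j * v j i))
    (+-cong (*-congʳ (reflexive (Vecₚ.insertAt-lookup ν t₁ z)))
            (sum-cong-≋ (λ j → *-congʳ (reflexive (Vecₚ.insertAt-punchIn ν t₁ z j)))))

  lincomb-+-scaleʳ : ∀ {t m} (a : Vector Carrier t) (v w : Fin t → Vector Carrier m) x i →
                     lincomb a (λ j i → v j i + x * w j i) i ≈ lincomb a v i + x * lincomb a w i
  lincomb-+-scaleʳ a v w x i = begin
    sum (λ j → a j * (v j i + x * w j i))
      ≈⟨ sum-cong-≋ (λ j → trans (distribˡ (a j) _ _) (+-congˡ (x∙yz≈y∙xz (a j) x (w j i)))) ⟩
    sum (λ j → a j * v j i + x * (a j * w j i))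
      ≈⟨ ∑-distrib-+ (λ j → a j * v j i) (λ j → x * (a j * w j i)) ⟩
    lincomb a v i + sum (λ j → x * (a j * w j i))
      ≈⟨ +-congˡ (sym (*-distribˡ-sum x (λ j → a j * w j i))) ⟩
    lincomb a v i + x * lincomb a w i ∎

  lincomb-+-rank1 : ∀ {t m} (a c : Vector Carrier t) (v : Fin t → Vector Carrier m) (y : Vector Carrier m) i →
    lincomb a (λ j i → v j i + c j * y i) i ≈ sum (λ j → a j * c j) * y i + lincomb a v i
  lincomb-+-rank1 a c v y i = begin
    sum (λ j → a j * (v j i + c j * y i))
      ≈⟨ sum-cong-≋ (λ j → trans (distribˡ (a j) _ _) (+-congˡ (sym (*-assoc (a j) (c j) (y i))))) ⟩
    sum (λ j → a j * v j i + (a j * c j) * y i)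
      ≈⟨ ∑-distrib-+ (λ j → a j * v j i) (λ j → (a j * c j) * y i) ⟩
    lincomb a v i + sum (λ j → (a j * c j) * y i)
      ≈⟨ +-congˡ (sym (*-distribʳ-sum (y i) (λ j → a j * c j))) ⟩
    lincomb a v i + sum (λ j → a j * c j) * y i
      ≈⟨ +-comm _ _ ⟩
    sum (λ j → a j * c j) * y i + lincomb a v i ∎

  inSpan-cong : ∀ {r m} {G : Fin r → Vector Carrier m} {u w} →
                (∀ i → u i ≈ w i) → InSpan G u → InSpan G w
  inSpan-cong u≈w (μ , u≈μG) = μ , λ i → trans (sym (u≈w i)) (u≈μG i)

  inSpan-0# : ∀ {r m} {G : Fin r → Vector Carrier m} → InSpan G (λ _ → 0#)
  inSpan-0# {G = G} = (λ _ → 0#) , λ i → sym (lincomb-zeroˡ G (λ _ → refl) i)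

  inSpan-+ : ∀ {r m} {G : Fin r → Vector Carrier m} {u w} →
             InSpan G u → InSpan G w → InSpan G (λ i → u i + w i)
  inSpan-+ {G = G} (μ , u≈μG) (ν , w≈νG) =
    (λ j → μ j + ν j) , λ i → trans (+-cong (u≈μG i) (w≈νG i)) (sym (lincomb-+ˡ μ ν G i))

  inSpan-* : ∀ {r m} {G : Fin r → Vector Carrier m} {u} x → InSpan G u → InSpan G (λ i → x * u i)
  inSpan-* {G = G} x (μ , u≈μG) =
    (λ j → x * μ j) , λ i → trans (*-congˡ (u≈μG i)) (sym (lincomb-*ˡ x μ G i))

  inSpan-neg : ∀ {r m} {G : Fin r → Vector Carrier m} {u} → InSpan G u → InSpan G (λ i → - u i)
  inSpan-neg = inSpan-cong (λ i → -1*x≈-x _) ∘ inSpan-* (- 1#)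

  lincomb-inSpan : ∀ {n r m} {G : Fin r → Vector Carrier m} (W : Fin n → Vector Carrier m) a →
                   (∀ j → InSpan G (W j) ⊎ a j ≈ 0#) → InSpan G (lincomb a W)
  lincomb-inSpan {zero}  W a _ = inSpan-0#
  lincomb-inSpan {suc n} W a terms = inSpan-+
    (Sum.[ inSpan-* (a zero) , (λ a₀≈0 → inSpan-cong (λ i → sym (trans (*-congʳ a₀≈0) (zeroˡ _))) inSpan-0#) ]
       (terms zero))
    (lincomb-inSpan (W ∘ suc) (a ∘ suc) (terms ∘ suc))

  LinearlyIndependent-cong : ∀ {t m} {v w : Fin t → Vector Carrier m} →
                             (∀ j i → v j i ≈ w j i) → LinearlyIndependent v → LinearlyIndependent w
  LinearlyIndependent-cong {v = v} {w} v≈w li a rel =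
    li a (λ i → trans (lincomb-congʳ a v w (λ j → v≈w j i)) (rel i))

  independent-restriction⇒independent : ∀ {t m k} {v : Fin t → Vector Carrier m} (ι : Fin k → Fin m) →
    LinearlyIndependent (λ j i → v j (ι i)) → LinearlyIndependent v
  independent-restriction⇒independent ι li a rel = li a (rel ∘ ι)

  independent-punchIn : ∀ {t m} (v : Fin (suc t) → Vector Carrier m) (t₁ : Fin (suc t)) →
                        LinearlyIndependent v → LinearlyIndependent (v ∘ punchIn t₁)
  independent-punchIn v t₁ li a rel j = trans
    (reflexive (≡.sym (Vecₚ.insertAt-punchIn a t₁ 0# j)))
    (li (insertAt a t₁ 0#)
        (λ i → trans (lincomb-insertAt a t₁ 0# v i) (trans (+-cong (zeroˡ _) (rel i)) (+-identityˡ _)))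
        (punchIn t₁ j))

  independent⇒¬inSpan-punchIn : ∀ {t m} {v : Fin (suc t) → Vector Carrier m} t₁ {z} →
    LinearlyIndependent v → InSpan (v ∘ punchIn t₁) (λ i → z * v t₁ i) → z ≈ 0#
  independent⇒¬inSpan-punchIn {v = v} t₁ {z} li (μ , zv≈μv) = -x≈0⇒x≈0 (trans
    (reflexive (≡.sym (Vecₚ.insertAt-lookup μ t₁ (- z))))
    (li (insertAt μ t₁ (- z)) relation t₁))
    where
      relation : ∀ i → lincomb (insertAt μ t₁ (- z)) v i ≈ 0#
      relation i = begin
        lincomb (insertAt μ t₁ (- z)) v i
          ≈⟨ lincomb-insertAt μ t₁ (- z) v i ⟩
        - z * v t₁ i + lincomb μ (v ∘ punchIn t₁) i
          ≈⟨ +-cong (sym (-‿distribˡ-* z (v t₁ i))) (sym (zv≈μv i)) ⟩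
        - (z * v t₁ i) + z * v t₁ i
          ≈⟨ -‿inverseˡ _ ⟩
        0# ∎

  independent⇒punchIn-distinct : ∀ {t m} {v : Fin (suc t) → Vector Carrier m} t₁ j →
    LinearlyIndependent v → ¬ (∀ i → v (punchIn t₁ j) i ≈ v t₁ i)
  independent⇒punchIn-distinct {v = v} t₁ j li same = 1≉0 (independent⇒¬inSpan-punchIn {v = v} t₁ li
    (basis j , λ i → trans (*-identityˡ _) (trans (sym (same i)) (sym (lincomb-basis j (v ∘ punchIn t₁) i)))))

  ¬¬-zero⊎lastNonzero : ∀ {n} (a : Vector Carrier n) →
    ¬ ¬ ((∀ i → a i ≈ 0#) ⊎ Σ (Fin n) λ k → ¬ a k ≈ 0# × (∀ i → toℕ k < toℕ i → a i ≈ 0#))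
  ¬¬-zero⊎lastNonzero {zero}  a = return (inj₁ λ ())
  ¬¬-zero⊎lastNonzero {suc n} a = ¬¬-zero⊎lastNonzero (a ∘ suc) >>= λ where
    (inj₂ (k , aₖ≉0 , above)) →
      return (inj₂ (suc k , aₖ≉0 , λ { (suc i) (ℕ.s≤s k<i) → above i k<i }))
    (inj₁ tail≈0) → ¬¬-excluded-middle >>= λ where
      (yes a₀≈0) → return (inj₁ λ { zero → a₀≈0 ; (suc i) → tail≈0 i })
      (no a₀≉0)  → return (inj₂ (zero , a₀≉0 , λ { (suc i) _ → tail≈0 i }))

  ¬¬-zero⊎nonzero : ∀ {n} (a : Vector Carrier n) → ¬ ¬ ((∀ i → a i ≈ 0#) ⊎ ∃ λ k → ¬ a k ≈ 0#)
  ¬¬-zero⊎nonzero a = ¬¬-map (Sum.map₂ λ (k , aₖ≉0 , _) → k , aₖ≉0) (¬¬-zero⊎lastNonzero a)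

  module Pivot {t m} (v : Fin (suc t) → Vector Carrier m) (i₀ : Fin m) (pivot≉0 : ¬ v zero i₀ ≈ 0#)
    where

    pivot⁻¹ : Carrier
    pivot⁻¹ = proj₁ (inverse (v zero i₀) pivot≉0)

    pivot⁻¹*pivot≈1 : pivot⁻¹ * v zero i₀ ≈ 1#
    pivot⁻¹*pivot≈1 = trans (*-comm _ _) (proj₂ (inverse (v zero i₀) pivot≉0))

    factor : Vector Carrier t
    factor j = - (v (suc j) i₀ * pivot⁻¹)

    reduced : Fin t → Vector Carrier m
    reduced j i = v (suc j) i + factor j * v zero i

    reduced-pivot : ∀ j → reduced j i₀ ≈ 0#
    reduced-pivot j = begin
      u + - (u * pivot⁻¹) * v zero i₀    ≈⟨ +-congˡ (sym (-‿distribˡ-* _ _)) ⟩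
      u + - ((u * pivot⁻¹) * v zero i₀)  ≈⟨ +-congˡ (-‿cong (*-assoc _ _ _)) ⟩
      u + - (u * (pivot⁻¹ * v zero i₀))  ≈⟨ +-congˡ (-‿cong (*-congˡ pivot⁻¹*pivot≈1)) ⟩
      u + - (u * 1#)                     ≈⟨ +-congˡ (-‿cong (*-identityʳ u)) ⟩
      u + - u                            ≈⟨ -‿inverseʳ u ⟩
      0#                                 ∎
      where u = v (suc j) i₀

    lift : Vector Carrier t → Vector Carrier (suc t)
    lift b = sum (λ j → b j * factor j) ∷ b

    lincomb-lift : ∀ b i → lincomb (lift b) v i ≈ lincomb b reduced i
    lincomb-lift b i = sym (lincomb-+-rank1 b factor (v ∘ suc) (v zero) i)

    independent⇒independent-reduced : LinearlyIndependent v → LinearlyIndependent reduced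
    independent⇒independent-reduced li b rel =
      li (lift b) (λ i → trans (lincomb-lift b i) (rel i)) ∘ suc

    dependent-reduced⇒dependent : LinearlyDependent reduced → LinearlyDependent v
    dependent-reduced⇒dependent (b , rel , j , bⱼ≉0) =
      lift b , (λ i → trans (lincomb-lift b i) (rel i)) , suc j , bⱼ≉0

    independent-reduced⇒independent : LinearlyIndependent reduced → LinearlyIndependent v
    independent-reduced⇒independent li a rel = λ
      { zero    → trans (sym head≈a₀) (sum-zero _ λ j → trans (*-congʳ (tail≈0 j)) (zeroˡ _))
      ; (suc j) → tail≈0 j }
      where
        head≈a₀ : sum (λ j → a (suc j) * factor j) ≈ a zero
        head≈a₀ = *-cancelʳ-nonzero pivot≉0 (+-cancelʳ _ _ _ (begin
          lincomb (lift (a ∘ suc)) v i₀          ≈⟨ lincomb-lift (a ∘ suc) i₀ ⟩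
          lincomb (a ∘ suc) reduced i₀           ≈⟨ lincomb-zeroʳ (a ∘ suc) reduced reduced-pivot ⟩
          0#                                     ≈⟨ sym (rel i₀) ⟩
          lincomb a v i₀                         ∎))
        tail≈0 : ∀ j → a (suc j) ≈ 0#
        tail≈0 = li (a ∘ suc) λ i → begin
          lincomb (a ∘ suc) reduced i            ≈⟨ sym (lincomb-lift (a ∘ suc) i) ⟩
          lincomb (lift (a ∘ suc)) v i           ≈⟨ lincomb-congˡ (lift (a ∘ suc)) a v lift≈a i ⟩
          lincomb a v i                          ≈⟨ rel i ⟩
          0#                                     ∎
          where
            lift≈a : ∀ j → lift (a ∘ suc) j ≈ a j
            lift≈a zero    = head≈a₀
            lift≈a (suc j) = refl

    reduced-preserves-column-relations : ∀ {n} (h : Fin n → Fin m) a →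
      (∀ s → lincomb a (λ u s → v s (h u)) s ≈ 0#) →
      ∀ s → lincomb a (λ u s → reduced s (h u)) s ≈ 0#
    reduced-preserves-column-relations h a rel s = begin
      lincomb a (λ u s → reduced s (h u)) s
        ≈⟨ lincomb-+-scaleʳ a (λ u s → v (suc s) (h u)) (λ u _ → v zero (h u)) (factor s) s ⟩
      lincomb a (λ u s → v s (h u)) (suc s) + factor s * lincomb a (λ u s → v s (h u)) zero
        ≈⟨ +-cong (rel (suc s)) (trans (*-congˡ (rel zero)) (zeroʳ _)) ⟩
      0# + 0#
        ≈⟨ +-identityʳ 0# ⟩
      0# ∎

    independent-reduced-columns⇒independent-columns : ∀ {n} (h : Fin n → Fin m) →
      LinearlyIndependent (λ u s → reduced s (h u)) → LinearlyIndependent (λ u s → v s ((i₀ ∷ h) u))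
    independent-reduced-columns⇒independent-columns h li a rel = λ
      { zero    → a₀≈0
      ; (suc j) → tail≈0 j }
      where
        tail≈0 : ∀ j → a (suc j) ≈ 0#
        tail≈0 = li (a ∘ suc) λ s → begin
          lincomb (a ∘ suc) (λ u s → reduced s (h u)) s
            ≈⟨ sym (+-identityˡ _) ⟩
          0# + lincomb (a ∘ suc) (λ u s → reduced s (h u)) s
            ≈⟨ +-congʳ (sym (trans (*-congˡ (reduced-pivot s)) (zeroʳ _))) ⟩
          a zero * reduced s i₀ + lincomb (a ∘ suc) (λ u s → reduced s (h u)) s
            ≈⟨ reduced-preserves-column-relations (i₀ ∷ h) a rel s ⟩
          0# ∎
        a₀≈0 : a zero ≈ 0#
        a₀≈0 = x*y≈0⇒x≈0 pivot≉0 (begin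
          a zero * v zero i₀
            ≈⟨ sym (+-identityʳ _) ⟩
          a zero * v zero i₀ + 0#
            ≈⟨ +-congˡ (sym (lincomb-zeroˡ (λ u s → v s (h u)) tail≈0 zero)) ⟩
          a zero * v zero i₀ + lincomb (a ∘ suc) (λ u s → v s (h u)) zero
            ≈⟨ rel zero ⟩
          0# ∎)

  ¬¬-independent⊎dependent : ∀ {t m} (v : Fin t → Vector Carrier m) →
                             ¬ ¬ (LinearlyIndependent v ⊎ LinearlyDependent v)
  ¬¬-independent⊎dependent {zero}  v = return (inj₁ λ _ _ ())
  ¬¬-independent⊎dependent {suc t} v = ¬¬-zero⊎nonzero (v zero) >>= λ where
    (inj₁ v₀≈0) →
      return (inj₂ (basis zero , (λ i → trans (lincomb-basis zero v i) (v₀≈0 i)) , zero , 1≉0))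
    (inj₂ (i₀ , pivot≉0)) → let open Pivot v i₀ pivot≉0 in
      ¬¬-map (Sum.map independent-reduced⇒independent dependent-reduced⇒dependent)
             (¬¬-independent⊎dependent reduced)

  ¬independent⇒¬¬dependent : ∀ {t m} (v : Fin t → Vector Carrier m) →
                             ¬ LinearlyIndependent v → ¬ ¬ LinearlyDependent v
  ¬independent⇒¬¬dependent v ¬li = ¬¬-independent⊎dependent v >>= λ where
    (inj₁ li)  → contradiction li ¬li
    (inj₂ dep) → return dep

  independent-rows⇒¬¬independent-columns : ∀ {t m} (v : Fin t → Vector Carrier m) →
    LinearlyIndependent v → ¬ ¬ (Σ (Fin t → Fin m) λ h → LinearlyIndependent (λ u s → v s (h u)))
  independent-rows⇒¬¬independent-columns {zero}  v li = return ((λ ()) , λ _ _ ())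
  independent-rows⇒¬¬independent-columns {suc t} v li = ¬¬-zero⊎nonzero (v zero) >>= λ where
    (inj₁ v₀≈0) →
      contradiction (li (basis zero) (λ i → trans (lincomb-basis zero v i) (v₀≈0 i)) zero) 1≉0
    (inj₂ (i₀ , pivot≉0)) → let open Pivot v i₀ pivot≉0 in
      ¬¬-map (λ (h , li′) → i₀ ∷ h , independent-reduced-columns⇒independent-columns h li′)
             (independent-rows⇒¬¬independent-columns reduced (independent⇒independent-reduced li))

  dependent-extension-inSpan : ∀ {r m} (v : Fin (suc r) → Vector Carrier m) →
    LinearlyIndependent (v ∘ suc) → LinearlyDependent v → InSpan (v ∘ suc) (v zero)
  dependent-extension-inSpan v li (a , rel , w , aʷ≉0) =
    inSpan-cong v₀≈ (inSpan-* a₀⁻¹ (inSpan-neg (a ∘ suc , λ _ → refl)))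
    where
      a₀≉0 : ¬ a zero ≈ 0#
      a₀≉0 a₀≈0 = aʷ≉0 (a≈0 w)
        where
          a≈0 : ∀ j → a j ≈ 0#
          a≈0 zero    = a₀≈0
          a≈0 (suc j) = li (a ∘ suc) (λ i → trans (sym (+-identityˡ _))
            (trans (+-congʳ (sym (trans (*-congʳ a₀≈0) (zeroˡ _)))) (rel i))) j
      a₀⁻¹ : Carrier
      a₀⁻¹ = proj₁ (inverse (a zero) a₀≉0)
      a₀⁻¹*a₀≈1 : a₀⁻¹ * a zero ≈ 1#
      a₀⁻¹*a₀≈1 = trans (*-comm _ _) (proj₂ (inverse (a zero) a₀≉0))
      v₀≈ : ∀ i → a₀⁻¹ * - lincomb (a ∘ suc) (v ∘ suc) i ≈ v zero i
      v₀≈ i = begin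
        a₀⁻¹ * - lincomb (a ∘ suc) (v ∘ suc) i  ≈⟨ *-congˡ (sym (+-inverseˡ-unique _ _ (rel i))) ⟩
        a₀⁻¹ * (a zero * v zero i)            ≈⟨ sym (*-assoc _ _ _) ⟩
        (a₀⁻¹ * a zero) * v zero i            ≈⟨ *-congʳ a₀⁻¹*a₀≈1 ⟩
        1# * v zero i                         ≈⟨ *-identityˡ _ ⟩
        v zero i                              ∎

  inSpan-restriction-zero⇒zero : ∀ {r m k} {G : Fin r → Vector Carrier m} {u} (ι : Fin k → Fin m) →
    LinearlyIndependent (λ j i → G j (ι i)) → InSpan G u → (∀ i → u (ι i) ≈ 0#) → ∀ i → u i ≈ 0#
  inSpan-restriction-zero⇒zero {G = G} ι li (μ , u≈μG) uι≈0 i =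
    trans (u≈μG i) (lincomb-zeroˡ G (li μ (λ i → trans (sym (u≈μG (ι i))) (uι≈0 i))) i)

  RankLE-cong : ∀ {m k} {M N : Matrix m k} r → (∀ i j → M i j ≈ N i j) → RankLE M r → RankLE N r
  RankLE-cong r M≈N rk (f , li) = rk (f , LinearlyIndependent-cong (λ u i → sym (M≈N i (f u))) li)

  RankLE-transpose : ∀ {m k} (M : Matrix m k) r → RankLE M r → RankLE (λ j i → M i j) r
  RankLE-transpose M r rk (h , rows-independent) =
    independent-rows⇒¬¬independent-columns (M ∘ h) rows-independent λ (f , li) →
    rk (f , independent-restriction⇒independent {v = λ u i → M i (f u)} h li)

module HankelColumns {c ℓ : Level} (F : Field c ℓ) (s : ℕ → Field.Carrier F) where
  open Field F hiding (zero)
  open FieldDefs F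
  open LinearAlgebra F
  open import Algebra.Properties.Ring ring using (+-inverseˡ-unique)
  open import Algebra.Properties.Semiring.Sum semiring using (sum-remove)
  open import Relation.Binary.Reasoning.Setoid setoid

  Hankel : (rows cols : ℕ) → Matrix rows cols
  Hankel rows cols i j = s (toℕ i ℕ.+ toℕ j)

  col : (P j : ℕ) → Vector Carrier P
  col P j t = s (toℕ t ℕ.+ j)

  cols : ∀ {k} P → (Fin k → ℕ) → Fin k → Vector Carrier P
  cols P h u = col P (h u)

  col-inject₁ : ∀ P j t → col (suc P) j (inject₁ t) ≈ col P j t
  col-inject₁ P j t = reflexive (≡.cong (λ i → s (i ℕ.+ j)) (Finₚ.toℕ-inject₁ t))

  col-suc : ∀ P j t → col (suc P) j (suc t) ≈ col P (suc j) t
  col-suc P j t = reflexive (≡.cong s (≡.sym (ℕₚ.+-suc (toℕ t) j)))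

  col-step : ∀ P j t → col (suc P) (suc j) (inject₁ t) ≈ col (suc P) j (suc t)
  col-step P j t = trans (col-inject₁ P (suc j) t) (sym (col-suc P j t))

  independent⇒independent-suc : ∀ {k P} (h : Fin k → ℕ) →
    LinearlyIndependent (cols P h) → LinearlyIndependent (cols (suc P) h)
  independent⇒independent-suc {P = P} h li = independent-restriction⇒independent inject₁
    (LinearlyIndependent-cong (λ u t → sym (col-inject₁ P (h u) t)) li)

  inSpan-truncate : ∀ {k P} (g : Fin k → ℕ) j →
    InSpan (cols (suc P) g) (col (suc P) j) → InSpan (cols P g) (col P j)
  inSpan-truncate {P = P} g j (μ , col≈μG) = μ , λ t → trans (sym (col-inject₁ P j t))
    (trans (col≈μG (inject₁ t))
           (lincomb-congʳ μ (λ u t → col (suc P) (g u) (inject₁ t)) (cols P g) (λ u → col-inject₁ P (g u) t)))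

  inSpan-truncation-zero⇒zero : ∀ {k P} {g : Fin k → ℕ} {u} → LinearlyIndependent (cols P g) →
    InSpan (cols (suc P) g) u → (∀ t → u (inject₁ t) ≈ 0#) → ∀ t → u t ≈ 0#
  inSpan-truncation-zero⇒zero {P = P} {g} li = inSpan-restriction-zero⇒zero inject₁
    (LinearlyIndependent-cong (λ u t → sym (col-inject₁ P (g u) t)) li)

  rankLE⇒dependent : ∀ {P Q r} → RankLE (Hankel (suc P) Q) r →
    (h : Fin (suc r) → ℕ) → (∀ u → h u < Q) → ¬ LinearlyIndependent (cols (suc P) h)
  rankLE⇒dependent rk h h<Q li = rk ((λ u → fromℕ< (h<Q u)) , LinearlyIndependent-cong
    (λ u t → reflexive (≡.cong (λ j → s (toℕ t ℕ.+ j)) (≡.sym (Finₚ.toℕ-fromℕ< (h<Q u))))) li)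

  module Shift {P Q r} (g : Fin r → ℕ) (g-independent : LinearlyIndependent (cols P g))
               (spans : ∀ j → j < Q → InSpan (cols (suc P) g) (col (suc P) j))
               (last-free : ∀ z → InSpan (cols P g) (λ t → z * col P Q t) → z ≈ 0#) where

    shifted : ∀ {n} → Vector Carrier n → ℕ → Vector Carrier (suc P)
    shifted a d = lincomb a (λ i → col (suc P) (d ℕ.+ toℕ i))

    shifted-suc : ∀ {n} (a : Vector Carrier n) k → (∀ i → k < toℕ i → a i ≈ 0#) →
      ∀ d → suc d ℕ.+ k < Q → (∀ t → shifted a d t ≈ 0#) → ∀ t → shifted a (suc d) t ≈ 0#
    shifted-suc a k above d bound shifted≈0 = inSpan-truncation-zero⇒zero g-independent
      (lincomb-inSpan _ a term-inSpan)
      (λ t → trans (lincomb-congʳ a (λ i t → col (suc P) (suc d ℕ.+ toℕ i) (inject₁ t))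
                                    (λ i t → col (suc P) (d ℕ.+ toℕ i) (suc t))
                                    (λ i → col-step P (d ℕ.+ toℕ i) t))
                   (shifted≈0 (suc t)))
      where
        term-inSpan : ∀ i → InSpan (cols (suc P) g) (col (suc P) (suc d ℕ.+ toℕ i)) ⊎ a i ≈ 0#
        term-inSpan i with toℕ i ℕₚ.≤? k
        ... | yes i≤k = inj₁ (spans _ (ℕₚ.≤-<-trans (ℕₚ.+-monoʳ-≤ (suc d) i≤k) bound))
        ... | no i≰k  = inj₂ (above i (ℕₚ.≰⇒> i≰k))

    shifted-zero : ∀ {n} (a : Vector Carrier n) k → (∀ i → k < toℕ i → a i ≈ 0#) →
      (∀ t → shifted a 0 t ≈ 0#) → ∀ d → d ℕ.+ k < Q → ∀ t → shifted a d t ≈ 0#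
    shifted-zero a k above shifted₀≈0 zero    _     = shifted₀≈0
    shifted-zero a k above shifted₀≈0 (suc d) bound = shifted-suc a k above d bound
      (shifted-zero a k above shifted₀≈0 d (ℕₚ.<-trans (ℕₚ.n<1+n _) bound))

    lastNonzero-impossible : ∀ {n} (a : Vector Carrier (suc n)) (k : Fin (suc n)) → toℕ k < Q →
      (∀ i → toℕ k < toℕ i → a i ≈ 0#) → (∀ t → lincomb a (cols (suc P) toℕ) t ≈ 0#) → a k ≈ 0#
    lastNonzero-impossible {n} a k k<Q above rel =
      last-free (a k) (inSpan-cong (λ t → sym (+-inverseˡ-unique _ _ (split t))) (inSpan-neg rest-inSpan))
      where
        d : ℕ
        d = Q ∸ suc (toℕ k)
        d+k+1≡Q : suc (d ℕ.+ toℕ k) ≡.≡ Q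
        d+k+1≡Q = ≡.trans (≡.sym (ℕₚ.+-suc d (toℕ k))) (ℕₚ.m∸n+n≡m k<Q)
        rest : Fin n → Vector Carrier P
        rest j = col P (suc (d ℕ.+ toℕ (punchIn k j)))
        rest-inSpan : InSpan (cols P g) (lincomb (a ∘ punchIn k) rest)
        rest-inSpan = lincomb-inSpan rest (a ∘ punchIn k) rest-term
          where
            rest-term : ∀ j → InSpan (cols P g) (rest j) ⊎ a (punchIn k j) ≈ 0#
            rest-term j with ℕₚ.<-cmp (toℕ (punchIn k j)) (toℕ k)
            ... | tri< below _ _  = inj₁ (inSpan-truncate g _ (spans _
                    (ℕₚ.≤-trans (ℕ.s≤s (ℕₚ.+-monoʳ-< d below)) (ℕₚ.≤-reflexive d+k+1≡Q))))
            ... | tri≈ _ same _   = contradiction (Finₚ.toℕ-injective same) (Finₚ.punchInᵢ≢i k j)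
            ... | tri> _ _ beyond = inj₂ (above _ beyond)
        split : ∀ t → a k * col P Q t + lincomb (a ∘ punchIn k) rest t ≈ 0#
        split t = begin
          a k * col P Q t + lincomb (a ∘ punchIn k) rest t
            ≈⟨ +-congʳ (*-congˡ (reflexive (≡.cong (λ j → col P j t) (≡.sym d+k+1≡Q)))) ⟩
          a k * col P (suc (d ℕ.+ toℕ k)) t + lincomb (a ∘ punchIn k) rest t
            ≈⟨ sym (sum-remove {i = k} (λ i → a i * col P (suc (d ℕ.+ toℕ i)) t)) ⟩
          lincomb a (λ i → col P (suc (d ℕ.+ toℕ i))) t
            ≈⟨ lincomb-congʳ a (λ i t → col P (suc (d ℕ.+ toℕ i)) t)
                               (λ i t → col (suc P) (d ℕ.+ toℕ i) (suc t))
                               (λ i → sym (col-suc P (d ℕ.+ toℕ i) t)) ⟩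
          shifted a d (suc t)
            ≈⟨ shifted-zero a (toℕ k) above rel d (ℕₚ.≤-reflexive d+k+1≡Q) (suc t) ⟩
          0# ∎

  rankLE-Hankel-shift : ∀ {P Q r} → suc r ≤ Q →
    RankLE (Hankel (suc P) Q) r → RankLE (Hankel P (suc Q)) r
  rankLE-Hankel-shift {P} {Q} {r} r<Q rk (f , li) with Finₚ.any? (λ u → toℕ (f u) ℕₚ.≟ Q)
  ... | no ∄Q = rankLE⇒dependent rk (toℕ ∘ f) below (independent⇒independent-suc (toℕ ∘ f) li)
    where
      below : ∀ u → toℕ (f u) < Q
      below u = ℕₚ.≤∧≢⇒< (ℕₚ.≤-pred (Finₚ.toℕ<n (f u))) (λ fu≡Q → ∄Q (u , fu≡Q))
  ... | yes (t₁ , ft₁≡Q) =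
    ¬¬-∀-< column-inSpan λ spans →
    ¬independent⇒¬¬dependent (cols (suc P) toℕ) (rankLE⇒dependent rk toℕ first<Q)
      λ (a , rel , w , aʷ≉0) →
    ¬¬-zero⊎lastNonzero a λ where
      (inj₁ a≈0)              → aʷ≉0 (a≈0 w)
      (inj₂ (k , aₖ≉0 , above)) →
        aₖ≉0 (Shift.lastNonzero-impossible g g-independent spans last-free
                a k (first<Q k) above rel)
    where
      first<Q : ∀ (u : Fin (suc r)) → toℕ u < Q
      first<Q u = ℕₚ.<-≤-trans (Finₚ.toℕ<n u) r<Q
      g : Fin r → ℕ
      g = toℕ ∘ f ∘ punchIn t₁
      g-independent : LinearlyIndependent (cols P g)
      g-independent = independent-punchIn (cols P (toℕ ∘ f)) t₁ li
      g<Q : ∀ j → g j < Q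
      g<Q j = ℕₚ.≤∧≢⇒< (ℕₚ.≤-pred (Finₚ.toℕ<n (f (punchIn t₁ j)))) λ gj≡Q →
        independent⇒punchIn-distinct {v = cols P (toℕ ∘ f)} t₁ j li
          (λ t → reflexive (≡.cong (λ i → col P i t) (≡.trans gj≡Q (≡.sym ft₁≡Q))))
      column-inSpan : ∀ j → j < Q → ¬ ¬ InSpan (cols (suc P) g) (col (suc P) j)
      column-inSpan j j<Q = ¬¬-map
        (dependent-extension-inSpan (cols (suc P) (j ∷ g)) (independent⇒independent-suc g g-independent))
        (¬independent⇒¬¬dependent (cols (suc P) (j ∷ g))
          (rankLE⇒dependent rk (j ∷ g) λ { zero → j<Q ; (suc u) → g<Q u }))
      last-free : ∀ z → InSpan (cols P g) (λ t → z * col P Q t) → z ≈ 0#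
      last-free z = independent⇒¬inSpan-punchIn {v = cols P (toℕ ∘ f)} t₁ li ∘
        inSpan-cong (λ t → *-congˡ (reflexive (≡.cong (λ i → col P i t) (≡.sym ft₁≡Q))))

  rankLE-Hankel-transpose : ∀ {m k r} → RankLE (Hankel m k) r → RankLE (Hankel k m) r
  rankLE-Hankel-transpose {m} {k} {r} rk = RankLE-cong r
    (λ i j → reflexive (≡.cong s (ℕₚ.+-comm (toℕ j) (toℕ i))))
    (RankLE-transpose (Hankel m k) r rk)

open import Data.Nat.Base using (_+_)
open import Function.Bundles using (_⇔_; mk⇔)

lemma2p4 : {c ℓ : Level} (F : Field c ℓ) (n p q r : ℕ) →
    p + q ≤ suc n → suc r ≤ p → suc r ≤ q →
    (x : Fin (suc n) → Field.Carrier F) →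
    FieldDefs.RankLE F (FieldDefs.hankel F (suc p) q x) r
      ⇔ FieldDefs.RankLE F (FieldDefs.hankel F p (suc q) x) r
-- The size bound p + q ≤ n + 1 is not needed: `entry` pads x with zeros, and the argument
-- above works for every sequence.
lemma2p4 F n p q r _ r<p r<q x = mk⇔
  (rankLE-Hankel-shift r<q)
  (rankLE-Hankel-transpose ∘ rankLE-Hankel-shift r<p ∘ rankLE-Hankel-transpose)
  where open HankelColumns F (FieldDefs.entry F x)
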